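{- Let $d\ge1$ and define $2^d\times 2^d$ signed matrices recursively by $$A_1=\begin{pmatrix}0&1\\1&0\end{pmatrix},\qquad A_d=\begin{pmatrix}A_{d-1}&I\\ I&-A_{d-1}\end{pmatrix},$$ where $I$ is the $2^{d-1}\times 2^{d-1}$ identity matrix. Let $X_d$ be the graph on $\{1,\dots,2^d\}$ with $i\sim j$ iff $(A_d)_{ij}\neq0$ (so $X_d\cong Q_d$). Then the $2$-fold cover of $X_d$ associated with the signed adjacency matrix $A_d$ is isomorphic to the Cohen–Tits cover of $Q_d$.
   Context: The $2$-fold cover associated with a signed adjacency matrix $\hat A$ of a graph $X$ is obtained by replacing each vertex $v$ by two vertices $v',v''$, and each edge $\{u,v\}$ by the edges $\{u',v''\},\{u'',v'\}$ if $\hat A_{uv}=-1$, or by $\{u',v'\},\{u'',v''\}$ if $\hat A_{uv}=1$. $Q_d$ is the $d$-dimensional hypercube. A graph $\tilde X$ is a cover of $Y$ if there is a homomorphism $\gamma:\tilde X\to Y$ with independent fibers such that for each edge $uv$ of $Y$ the subgraph induced on $\gamma^{ -1}(u)\cup\gamma^{ -1}(v)$ is a perfect matching; $2$-fold if fibers have size $2$. By a result of Cohen and Tits, there is a $2$-fold cover of $Q_d$ with no $4$-cycles, unique up to isomorphism; it is called the Cohen–Tits cover of $Q_d$. -}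

module Defs where

open import Data.Nat using (ℕ; zero; suc; _+_; _^_; NonZero)
open import Data.Nat.Properties using (+-identityʳ)
open import Data.Integer using (ℤ; 0ℤ; 1ℤ; -1ℤ; -_)
open import Data.Fin using (Fin; zero; suc; splitAt; cast)
open import Data.Fin.Properties using () renaming (_≟_ to _≟F_)
open import Data.Bool using (Bool; true; false; if_then_else_)
open import Data.Vec using (Vec; []; _∷_)
open import Data.Product using (Σ; _×_; _,_; ∃; ∃-syntax)
open import Data.Sum using (_⊎_; inj₁; inj₂)
open import Relation.Nullary using (¬_; does)
open import Relation.Binary.PropositionalEquality using (_≡_; _≢_)

record Graph : Set₁ where
  field
    V   : Set
    _~_ : V → V → Set
open Graph public

IsSimple : Graph → Set
IsSimple G = (∀ x y → _~_ G x y → _~_ G y x) × (∀ x → ¬ (_~_ G x x))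

ExactlyTwo : {A : Set} → (A → Set) → Set
ExactlyTwo {A} P = Σ A λ a → Σ A λ b →
  a ≢ b × P a × P b × (∀ c → P c → c ≡ a ⊎ c ≡ b)

∃! : {A : Set} → (A → Set) → Set
∃! {A} P = Σ A λ a → P a × (∀ b → P b → b ≡ a)

-- γ : V X → V Y is a 2-fold covering map (X is a 2-fold cover of Y via γ):
-- a homomorphism with independent fibres of size 2 such that for each edge
-- uv of Y the subgraph induced on γ⁻¹(u) ∪ γ⁻¹(v) is a perfect matching
-- (every vertex of it has exactly one neighbour inside it).
IsTwoFoldCovering : (X Y : Graph) → (V X → V Y) → Set
IsTwoFoldCovering X Y γ =
    (∀ x y → _~_ X x y → _~_ Y (γ x) (γ y))
  × (∀ x y → γ x ≡ γ y → ¬ (_~_ X x y))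
  × (∀ u → ExactlyTwo (λ x → γ x ≡ u))
  × (∀ u v → _~_ Y u v → ∀ x → (γ x ≡ u ⊎ γ x ≡ v) →
       ∃! (λ y → (γ y ≡ u ⊎ γ y ≡ v) × _~_ X x y))

IsTwoFoldCoverOf : Graph → Graph → Set
IsTwoFoldCoverOf X Y = Σ (V X → V Y) (IsTwoFoldCovering X Y)

HasFourCycle : Graph → Set
HasFourCycle X = Σ (V X) λ a → Σ (V X) λ b → Σ (V X) λ c → Σ (V X) λ e →
  a ≢ b × a ≢ c × a ≢ e × b ≢ c × b ≢ e × c ≢ e ×
  _~_ X a b × _~_ X b c × _~_ X c e × _~_ X e a

Isomorphic : Graph → Graph → Set
Isomorphic X Y = Σ (V X → V Y) λ f → Σ (V Y → V X) λ g →
  (∀ x → g (f x) ≡ x) × (∀ y → f (g y) ≡ y) ×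
  (∀ x x' → (_~_ X x x' → _~_ Y (f x) (f x')) × (_~_ Y (f x) (f x') → _~_ X x x'))

differ : {d : ℕ} → Vec Bool d → Vec Bool d → ℕ
differ [] [] = 0
differ (a ∷ u) (b ∷ v) = (if does (a Data.Bool.≟ b) then 0 else 1) + differ u v

Q : ℕ → Graph
Q d = record { V = Vec Bool d ; _~_ = λ u v → differ u v ≡ 1 }

-- The Cohen–Tits property: a simple 2-fold cover of Q_d without 4-cycles
-- (by Cohen–Tits such a cover exists and is unique up to isomorphism).
IsCohenTitsCover : ℕ → Graph → Set
IsCohenTitsCover d Y = IsSimple Y × IsTwoFoldCoverOf Y (Q d) × ¬ HasFourCycle Y

-- The signed matrices A_d (d ≥ 1), indices Fin (2 ^ d).
-- Note 2 ^ suc k reduces to 2 ^ k + (2 ^ k + 0), so we split indices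
-- into the first and second block.

half : (k : ℕ) → Fin (2 ^ suc k) → Fin (2 ^ k) ⊎ Fin (2 ^ k)
half k i with splitAt (2 ^ k) i
... | inj₁ a = inj₁ a
... | inj₂ b = inj₂ (cast (+-identityʳ (2 ^ k)) b)

δ : {n : ℕ} → Fin n → Fin n → ℤ
δ a b = if does (a ≟F b) then 1ℤ else 0ℤ

-- A′ k is the matrix A_{k+1}
A′ : (k : ℕ) → Fin (2 ^ suc k) → Fin (2 ^ suc k) → ℤ
A′ zero zero zero = 0ℤ
A′ zero zero (suc zero) = 1ℤ
A′ zero (suc zero) zero = 1ℤ
A′ zero (suc zero) (suc zero) = 0ℤ
A′ (suc k) i j with half (suc k) i | half (suc k) j
... | inj₁ a | inj₁ b = A′ k a b
... | inj₁ a | inj₂ b = δ a b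
... | inj₂ a | inj₁ b = δ a b
... | inj₂ a | inj₂ b = - A′ k a b

A : (d : ℕ) → {{NonZero d}} → Fin (2 ^ d) → Fin (2 ^ d) → ℤ
A (suc k) = A′ k

X : (d : ℕ) → {{NonZero d}} → Graph
X d = record { V = Fin (2 ^ d) ; _~_ = λ i j → A d i j ≢ 0ℤ }

-- The 2-fold cover associated with the signed adjacency matrix A_d:
-- vertex v is replaced by (v , false) = v' and (v , true) = v'';
-- an edge with sign +1 gives {u',v'},{u'',v''}; sign -1 gives {u',v''},{u'',v'}.
SignedCover : (d : ℕ) → {{NonZero d}} → Graph
SignedCover d = record
  { V = Fin (2 ^ d) × Bool
  ; _~_ = λ { (u , s) (v , t) →
        (A d u v ≡ 1ℤ × s ≡ t) ⊎ (A d u v ≡ -1ℤ × s ≢ t) } }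

{-# OPTIONS --safe #-}
-- Model the cover on Q_d × Bool: crossing direction i of the cube also switches
-- sheets iff an odd number of the coordinates before i are set. In binary
-- coordinates the entry of A_d between u and its i-th neighbour is (-1) to that
-- parity, so the signed cover of A_d is this model. Going around any square of
-- Q_d in the model ends in the opposite sheet, so the model has no 4-cycle.
-- Conversely, in a 2-fold cover of Q_d without 4-cycles, lifts of two distinct
-- directions cannot commute (that would close a 4-cycle), so they anticommute
-- modulo the fibre involution; writing each vertex as a word in the lifts applied
-- to a base point then identifies the cover with the model.

module Submission where

open import Defs
open import Data.Bool using (Bool; true; false; not; _xor_; if_then_else_) renaming (_≟_ to _≟ᵇ_)
open import Data.Bool.Properties
  using (not-¬; ¬-not; not-involutive; xor-assoc; xor-comm; xor-same; xor-identityʳ; not-distribˡ-xor; not-distribʳ-xor)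
open import Data.Empty using (⊥)
open import Data.Fin using (Fin; zero; suc; splitAt; cast; _↑ˡ_; _↑ʳ_; _≟_)
open import Data.Fin.Properties using (0≢1+n; suc-injective; splitAt-↑ˡ; splitAt-↑ʳ; splitAt⁻¹-↑ˡ; splitAt⁻¹-↑ʳ; cast-involutive)
open import Data.Integer using (ℤ; 0ℤ; 1ℤ; -1ℤ; -_)
open import Data.Nat using (ℕ; zero; suc; _+_; _^_; NonZero)
open import Data.Nat.Properties using (+-identityʳ)
import Data.Nat.Properties as ℕ
open import Data.Product using (Σ; _×_; _,_; proj₁; proj₂)
import Data.Product as Product
open import Data.Product.Properties using (,-injectiveʳ)
open import Data.Sum using (_⊎_; inj₁; inj₂)
import Data.Sum as Sum
open import Data.Vec using (Vec; []; _∷_; lookup; updateAt; replicate)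
open import Data.Vec.Properties
  using (lookup∘updateAt; lookup∘updateAt′; updateAt-updateAt-local; updateAt-id; updateAt-commutes)
import Data.Vec.Properties as Vec
open import Function using (_∘_; id)
open import Relation.Nullary using (¬_; does; yes; no; contradiction)
open import Relation.Binary.PropositionalEquality
open ≡-Reasoning

private
  variable
    S T : Set
    n : ℕ

-- The hypercube

flip : Fin n → Vec Bool n → Vec Bool n
flip i u = updateAt u i not

flip-involutive : (i : Fin n) (u : Vec Bool n) → flip i (flip i u) ≡ u
flip-involutive i u = trans (updateAt-updateAt-local i u (not-involutive _)) (updateAt-id i u)

flip-transpose : (i : Fin n) {u v : Vec Bool n} → flip i u ≡ v → u ≡ flip i v
flip-transpose i {u} e = trans (sym (flip-involutive i u)) (cong (flip i) e)

flip-≢ : (i : Fin n) (u : Vec Bool n) → flip i u ≢ u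
flip-≢ i u e = not-¬ refl (trans (cong (λ w → lookup w i) (sym e)) (lookup∘updateAt i u))

flip-injectiveˡ : {i j : Fin n} (u : Vec Bool n) → flip i u ≡ flip j u → i ≡ j
flip-injectiveˡ {i = i} {j} u e with i ≟ j
... | yes i≡j = i≡j
... | no i≢j = contradiction
  (trans (sym (lookup∘updateAt′ i j i≢j u)) (trans (cong (λ w → lookup w i) (sym e)) (lookup∘updateAt i u)))
  (not-¬ refl)

flip²-≢ : {i j : Fin n} (u : Vec Bool n) → i ≢ j → flip i (flip j u) ≢ u
flip²-≢ {i = i} u i≢j e = i≢j (flip-injectiveˡ u (sym (flip-transpose i e)))

flip²-square : {i j k l : Fin n} (u : Vec Bool n) → i ≢ j →
  flip j (flip i u) ≡ flip k (flip l u) → (k ≡ j × l ≡ i) ⊎ (k ≡ i × l ≡ j)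
flip²-square {i = i} {j} {k} {l} u i≢j square =
  combine (moved j (trans (sym (cong (λ w → lookup w j) square)) changed-at-j))
          (moved i (trans (sym (cong (λ w → lookup w i) square)) changed-at-i))
  where
  changed-at-j : lookup (flip j (flip i u)) j ≡ not (lookup u j)
  changed-at-j = trans (lookup∘updateAt j (flip i u)) (cong not (lookup∘updateAt′ j i (i≢j ∘ sym) u))
  changed-at-i : lookup (flip j (flip i u)) i ≡ not (lookup u i)
  changed-at-i = trans (lookup∘updateAt′ i j i≢j (flip i u)) (lookup∘updateAt i u)
  moved : ∀ m → lookup (flip k (flip l u)) m ≡ not (lookup u m) → k ≡ m ⊎ l ≡ m
  moved m changed with k ≟ m | l ≟ m
  ... | yes k≡m | _ = inj₁ k≡m
  ... | no _ | yes l≡m = inj₂ l≡m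
  ... | no k≢m | no l≢m = contradiction
    (trans (sym (trans (lookup∘updateAt′ m k (k≢m ∘ sym) (flip l u)) (lookup∘updateAt′ m l (l≢m ∘ sym) u))) changed)
    (not-¬ refl)
  combine : (k ≡ j ⊎ l ≡ j) → (k ≡ i ⊎ l ≡ i) → (k ≡ j × l ≡ i) ⊎ (k ≡ i × l ≡ j)
  combine (inj₁ k≡j) (inj₁ k≡i) = contradiction (trans (sym k≡i) k≡j) i≢j
  combine (inj₁ k≡j) (inj₂ l≡i) = inj₁ (k≡j , l≡i)
  combine (inj₂ l≡j) (inj₁ k≡i) = inj₂ (k≡i , l≡j)
  combine (inj₂ l≡j) (inj₂ l≡i) = contradiction (trans (sym l≡i) l≡j) i≢j

edge-direction-unique : {i j : Fin n} {u w : Vec Bool n} →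
  (w ≡ u ⊎ w ≡ flip i u) → (flip j w ≡ u ⊎ flip j w ≡ flip i u) → j ≡ i
edge-direction-unique {j = j} {u} (inj₁ refl) (inj₁ e) = contradiction e (flip-≢ j u)
edge-direction-unique {u = u} (inj₁ refl) (inj₂ e) = flip-injectiveˡ u e
edge-direction-unique {j = j} {u} (inj₂ refl) (inj₁ e) = sym (flip-injectiveˡ u (flip-transpose j e))
edge-direction-unique {j = j} (inj₂ refl) (inj₂ e) = contradiction e (flip-≢ j _)

differ-refl : (u : Vec Bool n) → differ u u ≡ 0
differ-refl [] = refl
differ-refl (false ∷ u) = differ-refl u
differ-refl (true ∷ u) = differ-refl u

differ≡0⇒≡ : (u v : Vec Bool n) → differ u v ≡ 0 → u ≡ v
differ≡0⇒≡ [] [] _ = refl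
differ≡0⇒≡ (false ∷ u) (false ∷ v) e = cong (false ∷_) (differ≡0⇒≡ u v e)
differ≡0⇒≡ (true ∷ u) (true ∷ v) e = cong (true ∷_) (differ≡0⇒≡ u v e)

differ-flip : (i : Fin n) (u : Vec Bool n) → differ u (flip i u) ≡ 1
differ-flip zero (false ∷ u) = cong suc (differ-refl u)
differ-flip zero (true ∷ u) = cong suc (differ-refl u)
differ-flip (suc i) (false ∷ u) = differ-flip i u
differ-flip (suc i) (true ∷ u) = differ-flip i u

differ≡1⇒flip : (u v : Vec Bool n) → differ u v ≡ 1 → Σ (Fin n) λ i → v ≡ flip i u
differ≡1⇒flip [] [] ()
differ≡1⇒flip (false ∷ u) (true ∷ v) e = zero , cong (true ∷_) (sym (differ≡0⇒≡ u v (ℕ.suc-injective e)))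
differ≡1⇒flip (true ∷ u) (false ∷ v) e = zero , cong (false ∷_) (sym (differ≡0⇒≡ u v (ℕ.suc-injective e)))
differ≡1⇒flip (false ∷ u) (false ∷ v) e = Product.map suc (cong (false ∷_)) (differ≡1⇒flip u v e)
differ≡1⇒flip (true ∷ u) (true ∷ v) e = Product.map suc (cong (true ∷_)) (differ≡1⇒flip u v e)

prefixParity : Vec Bool n → Fin n → Bool
prefixParity (b ∷ u) zero = false
prefixParity (b ∷ u) (suc i) = b xor prefixParity u i

prefixParity-flip-self : (i : Fin n) (u : Vec Bool n) → prefixParity (flip i u) i ≡ prefixParity u i
prefixParity-flip-self zero (b ∷ u) = refl
prefixParity-flip-self (suc i) (b ∷ u) = cong (b xor_) (prefixParity-flip-self i u)

xor-cancel-common : ∀ b p q → (b xor p) xor (b xor q) ≡ p xor q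
xor-cancel-common false p q = refl
xor-cancel-common true false q = not-involutive q
xor-cancel-common true true q = refl

prefixParity-flip-anticomm : {i j : Fin n} (u : Vec Bool n) → i ≢ j →
  prefixParity u i xor prefixParity (flip i u) j ≡ not (prefixParity u j xor prefixParity (flip j u) i)
prefixParity-flip-anticomm {i = zero} {zero} (b ∷ u) 0≢0 = contradiction refl 0≢0
prefixParity-flip-anticomm {i = zero} {suc j} (b ∷ u) _ =
  trans (sym (not-distribˡ-xor b _)) (cong not (sym (xor-identityʳ _)))
prefixParity-flip-anticomm {i = suc i} {zero} (b ∷ u) _ =
  trans (xor-identityʳ _) (sym (trans (cong not (sym (not-distribˡ-xor b _))) (not-involutive _)))
prefixParity-flip-anticomm {i = suc i} {suc j} (b ∷ u) i≢j = begin
  (b xor prefixParity u i) xor (b xor prefixParity (flip i u) j)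
    ≡⟨ xor-cancel-common b _ _ ⟩
  prefixParity u i xor prefixParity (flip i u) j
    ≡⟨ prefixParity-flip-anticomm u (i≢j ∘ cong suc) ⟩
  not (prefixParity u j xor prefixParity (flip j u) i)
    ≡⟨ cong not (sym (xor-cancel-common b _ _)) ⟩
  not ((b xor prefixParity u j) xor (b xor prefixParity (flip j u) i)) ∎

-- Words in anticommuting involutions

applyIf : Bool → (S → S) → S → S
applyIf b h = if b then h else id

applyIf-xor : {h : S → S} → (∀ x → h (h x) ≡ x) →
  ∀ s c x → applyIf s h (applyIf c h x) ≡ applyIf (s xor c) h x
applyIf-xor h-involutive false c x = refl
applyIf-xor h-involutive true false x = refl
applyIf-xor h-involutive true true x = h-involutive x

applyIf-commute : {h k : S → S} → (∀ x → k (h x) ≡ h (k x)) →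
  ∀ b x → k (applyIf b h x) ≡ applyIf b h (k x)
applyIf-commute comm false x = refl
applyIf-commute comm true x = comm x

applyIf-injective : {h : S → S} → (∀ x → h x ≢ x) →
  ∀ {s t} x → applyIf s h x ≡ applyIf t h x → s ≡ t
applyIf-injective fixpoint-free {false} {false} x e = refl
applyIf-injective fixpoint-free {false} {true} x e = contradiction (sym e) (fixpoint-free x)
applyIf-injective fixpoint-free {true} {false} x e = contradiction e (fixpoint-free x)
applyIf-injective fixpoint-free {true} {true} x e = refl

applyWhere : (Fin n → S → S) → Vec Bool n → S → S
applyWhere σ [] x = x
applyWhere σ (b ∷ u) x = applyIf b (σ zero) (applyWhere (σ ∘ suc) u x)

applyWhere-natural : (h : S → T) (σ : Fin n → S → S) (τ : Fin n → T → T) →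
  (∀ i x → h (σ i x) ≡ τ i (h x)) →
  ∀ u x → h (applyWhere σ u x) ≡ applyWhere τ u (h x)
applyWhere-natural h σ τ comm [] x = refl
applyWhere-natural h σ τ comm (false ∷ u) x =
  applyWhere-natural h (σ ∘ suc) (τ ∘ suc) (comm ∘ suc) u x
applyWhere-natural h σ τ comm (true ∷ u) x =
  trans (comm zero _) (cong (τ zero) (applyWhere-natural h (σ ∘ suc) (τ ∘ suc) (comm ∘ suc) u x))

applyWhere-flip : (u : Vec Bool n) → applyWhere flip u (replicate n false) ≡ u
applyWhere-flip [] = refl
applyWhere-flip {suc n} (b ∷ u) = begin
  applyIf b (flip zero) (applyWhere (flip ∘ suc) u (false ∷ replicate n false))
    ≡⟨ cong (applyIf b (flip zero))
         (sym (applyWhere-natural (false ∷_) flip (flip ∘ suc) (λ _ _ → refl) u _)) ⟩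
  applyIf b (flip zero) (false ∷ applyWhere flip u (replicate n false))
    ≡⟨ cong (λ w → applyIf b (flip zero) (false ∷ w)) (applyWhere-flip u) ⟩
  applyIf b (flip zero) (false ∷ u)
    ≡⟨ set-head b ⟩
  b ∷ u ∎
  where
  set-head : ∀ b → applyIf b (flip zero) (false ∷ u) ≡ b ∷ u
  set-head false = refl
  set-head true = refl

record AnticommutingFamily (ω : S → S) (σ : Fin n → S → S) : Set where
  field
    ω-involutive : ∀ x → ω (ω x) ≡ x
    σ-involutive : ∀ i x → σ i (σ i x) ≡ x
    σ-ω-comm     : ∀ i x → σ i (ω x) ≡ ω (σ i x)
    σ-anticomm   : ∀ i j → i ≢ j → ∀ x → σ i (σ j x) ≡ ω (σ j (σ i x))

AnticommutingFamily-suc : {ω : S → S} {σ : Fin (suc n) → S → S} →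
  AnticommutingFamily ω σ → AnticommutingFamily ω (σ ∘ suc)
AnticommutingFamily-suc F = record
  { ω-involutive = ω-involutive
  ; σ-involutive = σ-involutive ∘ suc
  ; σ-ω-comm     = σ-ω-comm ∘ suc
  ; σ-anticomm   = λ i j i≢j → σ-anticomm (suc i) (suc j) (i≢j ∘ suc-injective)
  }
  where open AnticommutingFamily F

-- Moving σ i through a word to its slot i costs one ω for each earlier letter.
σ-applyWhere : {ω : S → S} {σ : Fin n → S → S} → AnticommutingFamily ω σ →
  ∀ u i x → σ i (applyWhere σ u x) ≡ applyIf (prefixParity u i) ω (applyWhere σ (flip i u) x)
σ-applyWhere F (false ∷ u) zero x = refl
σ-applyWhere F (true ∷ u) zero x = AnticommutingFamily.σ-involutive F zero _
σ-applyWhere F (false ∷ u) (suc i) x = σ-applyWhere (AnticommutingFamily-suc F) u i x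
σ-applyWhere {ω = ω} {σ} F (true ∷ u) (suc i) x = begin
  σ (suc i) (σ zero (applyWhere (σ ∘ suc) u x))
    ≡⟨ σ-anticomm (suc i) zero (0≢1+n ∘ sym) _ ⟩
  ω (σ zero (σ (suc i) (applyWhere (σ ∘ suc) u x)))
    ≡⟨ cong (ω ∘ σ zero) (σ-applyWhere (AnticommutingFamily-suc F) u i x) ⟩
  ω (σ zero (applyIf c ω (applyWhere (σ ∘ suc) (flip i u) x)))
    ≡⟨ cong ω (applyIf-commute (σ-ω-comm zero) c _) ⟩
  ω (applyIf c ω (σ zero (applyWhere (σ ∘ suc) (flip i u) x)))
    ≡⟨ applyIf-xor ω-involutive true c _ ⟩
  applyIf (not c) ω (σ zero (applyWhere (σ ∘ suc) (flip i u) x)) ∎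
  where
  open AnticommutingFamily F
  c : Bool
  c = prefixParity u i

-- A model of the Cohen–Tits cover

-- The sheet changes iff the entry of A_d between u and flip i u is -1 (see Aᵇ-flip).
step : {d : ℕ} → Fin d → Vec Bool d × Bool → Vec Bool d × Bool
step i (u , s) = flip i u , s xor prefixParity u i

sheetSwap : {d : ℕ} → Vec Bool d × Bool → Vec Bool d × Bool
sheetSwap (u , s) = u , not s

sheetSwap-≢ : {d : ℕ} (x : Vec Bool d × Bool) → sheetSwap x ≢ x
sheetSwap-≢ x e = not-¬ refl (sym (cong proj₂ e))

step-involutive : {d : ℕ} (i : Fin d) (x : Vec Bool d × Bool) → step i (step i x) ≡ x
step-involutive i (u , s) = cong₂ _,_ (flip-involutive i u) (begin
  (s xor prefixParity u i) xor prefixParity (flip i u) i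
    ≡⟨ cong ((s xor prefixParity u i) xor_) (prefixParity-flip-self i u) ⟩
  (s xor prefixParity u i) xor prefixParity u i
    ≡⟨ xor-assoc s _ _ ⟩
  s xor (prefixParity u i xor prefixParity u i)
    ≡⟨ cong (s xor_) (xor-same (prefixParity u i)) ⟩
  s xor false
    ≡⟨ xor-identityʳ s ⟩
  s ∎)

step-anticomm : {d : ℕ} {i j : Fin d} → i ≢ j → (x : Vec Bool d × Bool) →
  step i (step j x) ≡ sheetSwap (step j (step i x))
step-anticomm {i = i} {j} i≢j (u , s) = cong₂ _,_ (updateAt-commutes i j i≢j u) (begin
  (s xor prefixParity u j) xor prefixParity (flip j u) i
    ≡⟨ xor-assoc s _ _ ⟩
  s xor (prefixParity u j xor prefixParity (flip j u) i)
    ≡⟨ cong (s xor_) (prefixParity-flip-anticomm u (i≢j ∘ sym)) ⟩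
  s xor not (prefixParity u i xor prefixParity (flip i u) j)
    ≡⟨ sym (not-distribʳ-xor s _) ⟩
  not (s xor (prefixParity u i xor prefixParity (flip i u) j))
    ≡⟨ cong not (sym (xor-assoc s _ _)) ⟩
  not ((s xor prefixParity u i) xor prefixParity (flip i u) j) ∎)

ParityCover : ℕ → Graph
ParityCover d = record { V = Vec Bool d × Bool ; _~_ = λ x y → Σ (Fin d) λ i → y ≡ step i x }

parityCover-isSimple : (d : ℕ) → IsSimple (ParityCover d)
parityCover-isSimple d =
  (λ x y (i , y≡) → i , trans (sym (step-involutive i x)) (cong (step i) (sym y≡))) ,
  (λ x (i , x≡) → flip-≢ i (proj₁ x) (sym (cong proj₁ x≡)))

parityCover-covering : (d : ℕ) → IsTwoFoldCovering (ParityCover d) (Q d) proj₁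
parityCover-covering d = homomorphism , independent , fibres , matching
  where
  homomorphism : ∀ x y → _~_ (ParityCover d) x y → differ (proj₁ x) (proj₁ y) ≡ 1
  homomorphism (u , s) _ (i , refl) = differ-flip i u
  independent : ∀ x y → proj₁ x ≡ proj₁ y → ¬ _~_ (ParityCover d) x y
  independent (u , s) _ u≡ (i , refl) = flip-≢ i u (sym u≡)
  fibres : ∀ u → ExactlyTwo (λ x → proj₁ x ≡ u)
  fibres u = (u , false) , (u , true) , (λ e → contradiction (,-injectiveʳ e) λ ()) , refl , refl , sheet
    where
    sheet : ∀ x → proj₁ x ≡ u → x ≡ (u , false) ⊎ x ≡ (u , true)
    sheet (_ , false) refl = inj₁ refl
    sheet (_ , true) refl = inj₂ refl
  matching : ∀ u v → differ u v ≡ 1 → ∀ x → (proj₁ x ≡ u ⊎ proj₁ x ≡ v) →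
    ∃! (λ y → (proj₁ y ≡ u ⊎ proj₁ y ≡ v) × _~_ (ParityCover d) x y)
  matching u v uv x x-end with differ≡1⇒flip u v uv
  ... | i , refl = step i x , (other-end x-end , i , refl) , unique
    where
    other-end : ∀ {w} → (w ≡ u ⊎ w ≡ flip i u) → (flip i w ≡ u ⊎ flip i w ≡ flip i u)
    other-end (inj₁ refl) = inj₂ refl
    other-end (inj₂ refl) = inj₁ (flip-involutive i u)
    unique : ∀ y → (proj₁ y ≡ u ⊎ proj₁ y ≡ flip i u) × _~_ (ParityCover d) x y → y ≡ step i x
    unique _ (y-end , j , refl) = cong (λ k → step k x) (edge-direction-unique x-end y-end)

parityCover-noFourCycle : (d : ℕ) → ¬ HasFourCycle (ParityCover d)
parityCover-noFourCycle d
  (a , _ , _ , _ , _ , a≢c , _ , _ , b≢e , _ , (i , refl) , (j , refl) , (k , refl) , (l , a≡)) =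
  closes (flip²-square (proj₁ a) i≢j (cong proj₁ square))
  where
  e≡ : step k (step j (step i a)) ≡ step l a
  e≡ = trans (sym (step-involutive l _)) (cong (step l) (sym a≡))
  square : step j (step i a) ≡ step k (step l a)
  square = trans (sym (step-involutive k _)) (cong (step k) e≡)
  i≢j : i ≢ j
  i≢j refl = a≢c (sym (step-involutive i a))
  closes : (k ≡ j × l ≡ i) ⊎ (k ≡ i × l ≡ j) → ⊥
  closes (inj₁ (_ , l≡i)) = b≢e (sym (trans e≡ (cong (λ m → step m a) l≡i)))
  closes (inj₂ (k≡i , l≡j)) = sheetSwap-≢ (step j (step i a)) (sym (begin
    step j (step i a)           ≡⟨ square ⟩
    step k (step l a)           ≡⟨ cong₂ (λ m m′ → step m (step m′ a)) k≡i l≡j ⟩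
    step i (step j a)           ≡⟨ step-anticomm i≢j a ⟩
    sheetSwap (step j (step i a)) ∎))

parityCover-isCohenTits : (d : ℕ) → IsCohenTitsCover d (ParityCover d)
parityCover-isCohenTits d =
  parityCover-isSimple d , (proj₁ , parityCover-covering d) , parityCover-noFourCycle d

-- Uniqueness

ExactlyTwo-other : {P : S → Set} → ExactlyTwo P → ∀ x → P x →
  Σ S λ y → P y × y ≢ x × (∀ z → P z → z ≡ x ⊎ z ≡ y)
ExactlyTwo-other (a , b , a≢b , Pa , Pb , only) x Px with only x Px
... | inj₁ refl = b , Pb , a≢b ∘ sym , only
... | inj₂ refl = a , Pa , a≢b , λ z Pz → Sum.swap (only z Pz)

module CoverOfCube {d : ℕ} (Y : Graph) (γ : V Y → Vec Bool d)
                   (covering : IsTwoFoldCovering Y (Q d) γ)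
                   (~-sym : ∀ x y → _~_ Y x y → _~_ Y y x) where

  private
    _≈_ : V Y → V Y → Set
    _≈_ = _~_ Y

    homomorphism : ∀ x y → x ≈ y → differ (γ x) (γ y) ≡ 1
    homomorphism = proj₁ covering

    independent : ∀ x y → γ x ≡ γ y → ¬ x ≈ y
    independent = proj₁ (proj₂ covering)

    fibres : ∀ u → ExactlyTwo (λ x → γ x ≡ u)
    fibres = proj₁ (proj₂ (proj₂ covering))

    matching : ∀ u v → differ u v ≡ 1 → ∀ x → (γ x ≡ u ⊎ γ x ≡ v) →
      ∃! (λ y → (γ y ≡ u ⊎ γ y ≡ v) × x ≈ y)
    matching = proj₂ (proj₂ (proj₂ covering))

    otherInFibre : ∀ x → Σ (V Y) λ y → γ y ≡ γ x × y ≢ x × (∀ z → γ z ≡ γ x → z ≡ x ⊎ z ≡ y)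
    otherInFibre x = ExactlyTwo-other (fibres (γ x)) x refl

  swap : V Y → V Y
  swap x = proj₁ (otherInFibre x)

  γ-swap : ∀ x → γ (swap x) ≡ γ x
  γ-swap x = proj₁ (proj₂ (otherInFibre x))

  swap-≢ : ∀ x → swap x ≢ x
  swap-≢ x = proj₁ (proj₂ (proj₂ (otherInFibre x)))

  fibre : ∀ x y → γ y ≡ γ x → y ≡ x ⊎ y ≡ swap x
  fibre x = proj₂ (proj₂ (proj₂ (otherInFibre x)))

  same-fibre : ∀ x y → γ y ≡ γ x → y ≢ x → y ≡ swap x
  same-fibre x y y-over y≢x with fibre x y y-over
  ... | inj₁ y≡x = contradiction y≡x y≢x
  ... | inj₂ y≡swap = y≡swap

  swap-involutive : ∀ x → swap (swap x) ≡ x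
  swap-involutive x = sym (same-fibre (swap x) x (sym (γ-swap x)) (swap-≢ x ∘ sym))

  private
    lifting : ∀ i x → ∃! (λ y → (γ y ≡ γ x ⊎ γ y ≡ flip i (γ x)) × x ≈ y)
    lifting i x = matching (γ x) (flip i (γ x)) (differ-flip i (γ x)) x (inj₁ refl)

  lift : Fin d → V Y → V Y
  lift i x = proj₁ (lifting i x)

  lift-adjacent : ∀ i x → x ≈ lift i x
  lift-adjacent i x = proj₂ (proj₁ (proj₂ (lifting i x)))

  γ-lift : ∀ i x → γ (lift i x) ≡ flip i (γ x)
  γ-lift i x with proj₁ (proj₁ (proj₂ (lifting i x)))
  ... | inj₁ same = contradiction (lift-adjacent i x) (independent x (lift i x) (sym same))
  ... | inj₂ flipped = flipped

  lift-unique : ∀ i x y → x ≈ y → γ y ≡ flip i (γ x) → y ≡ lift i x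
  lift-unique i x y x≈y y-over = proj₂ (proj₂ (lifting i x)) y (inj₂ y-over , x≈y)

  lift-involutive : ∀ i x → lift i (lift i x) ≡ x
  lift-involutive i x = sym (lift-unique i (lift i x) x (~-sym _ _ (lift-adjacent i x))
    (sym (trans (cong (flip i) (γ-lift i x)) (flip-involutive i (γ x)))))

  lift-swap : ∀ i x → lift i (swap x) ≡ swap (lift i x)
  lift-swap i x = same-fibre (lift i x) (lift i (swap x))
    (trans (γ-lift i (swap x)) (trans (cong (flip i) (γ-swap x)) (sym (γ-lift i x))))
    (λ e → swap-≢ x (trans (sym (lift-involutive i (swap x))) (trans (cong (lift i) e) (lift-involutive i x))))

  -- Lifts of two directions always close up to a square in the cube, but cannot
  -- close up to a 4-cycle in Y, so they land in opposite sheets.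
  lift-anticomm : ¬ HasFourCycle Y → ∀ i j → i ≢ j → ∀ x → lift i (lift j x) ≡ swap (lift j (lift i x))
  lift-anticomm no-square i j i≢j x = same-fibre (lift j (lift i x)) (lift i (lift j x))
    (trans γc (sym (trans (γ-lift j (lift i x)) (trans (cong (flip j) (γ-lift i x)) (updateAt-commutes j i (i≢j ∘ sym) u)))))
    λ closed → no-square (x , lift j x , lift i (lift j x) , lift i x ,
      apart refl (γ-lift j x) (flip-≢ j u ∘ sym) ,
      apart refl γc (flip²-≢ u i≢j ∘ sym) ,
      apart refl (γ-lift i x) (flip-≢ i u ∘ sym) ,
      apart (γ-lift j x) γc (flip-≢ i (flip j u) ∘ sym) ,
      apart (γ-lift j x) (γ-lift i x) (i≢j ∘ sym ∘ flip-injectiveˡ u) ,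
      apart γc (γ-lift i x) (λ e → flip-≢ j u (trans (flip-transpose i e) (flip-involutive i u))) ,
      lift-adjacent j x , lift-adjacent i (lift j x) ,
      subst (_≈ lift i x) (sym closed) (~-sym _ _ (lift-adjacent j (lift i x))) ,
      ~-sym _ _ (lift-adjacent i x))
    where
    u : Vec Bool d
    u = γ x
    γc : γ (lift i (lift j x)) ≡ flip i (flip j u)
    γc = trans (γ-lift i (lift j x)) (cong (flip i) (γ-lift j x))
    apart : ∀ {p q P R} → γ p ≡ P → γ q ≡ R → P ≢ R → p ≢ q
    apart p-over q-over P≢R p≡q = P≢R (trans (sym p-over) (trans (cong γ p≡q) q-over))

  module _ (no-square : ¬ HasFourCycle Y) where

    private
      lifts : AnticommutingFamily swap lift
      lifts = record
        { ω-involutive = swap-involutive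
        ; σ-involutive = lift-involutive
        ; σ-ω-comm     = lift-swap
        ; σ-anticomm   = lift-anticomm no-square
        }

      base : V Y
      base = proj₁ (fibres (replicate d false))

      γ-base : γ base ≡ replicate d false
      γ-base = proj₁ (proj₂ (proj₂ (proj₂ (fibres (replicate d false)))))

    section : Vec Bool d → V Y
    section u = applyWhere lift u base

    γ-section : ∀ u → γ (section u) ≡ u
    γ-section u = begin
      γ (applyWhere lift u base)     ≡⟨ applyWhere-natural γ lift flip γ-lift u base ⟩
      applyWhere flip u (γ base)     ≡⟨ cong (applyWhere flip u) γ-base ⟩
      applyWhere flip u (replicate d false) ≡⟨ applyWhere-flip u ⟩
      u ∎

    embed : Vec Bool d × Bool → V Y
    embed (u , s) = applyIf s swap (section u)

    γ-embed : ∀ u s → γ (embed (u , s)) ≡ u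
    γ-embed u false = γ-section u
    γ-embed u true = trans (γ-swap (section u)) (γ-section u)

    embed-injective : ∀ {x x′} → embed x ≡ embed x′ → x ≡ x′
    embed-injective {u , s} {u′ , t} e with trans (sym (γ-embed u s)) (trans (cong γ e) (γ-embed u′ t))
    ... | refl = cong (u ,_) (applyIf-injective swap-≢ (section u) e)

    embed-step : ∀ i x → lift i (embed x) ≡ embed (step i x)
    embed-step i (u , s) = begin
      lift i (applyIf s swap (section u))
        ≡⟨ applyIf-commute (lift-swap i) s _ ⟩
      applyIf s swap (lift i (section u))
        ≡⟨ cong (applyIf s swap) (σ-applyWhere lifts u i base) ⟩
      applyIf s swap (applyIf (prefixParity u i) swap (section (flip i u)))
        ≡⟨ applyIf-xor swap-involutive s _ _ ⟩
      applyIf (s xor prefixParity u i) swap (section (flip i u)) ∎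

    sheet : ∀ y → Σ Bool λ s → embed (γ y , s) ≡ y
    sheet y with fibre (section (γ y)) y (sym (γ-section (γ y)))
    ... | inj₁ y≡ = false , sym y≡
    ... | inj₂ y≡ = true , sym y≡

    project : V Y → Vec Bool d × Bool
    project y = γ y , proj₁ (sheet y)

    parityCover≅ : Isomorphic (ParityCover d) Y
    parityCover≅ = embed , project , project-embed , embed-project , λ x x′ → preserves x x′ , reflects x x′
      where
      embed-project : ∀ y → embed (project y) ≡ y
      embed-project y = proj₂ (sheet y)
      project-embed : ∀ x → project (embed x) ≡ x
      project-embed x = embed-injective (embed-project (embed x))
      preserves : ∀ x x′ → _~_ (ParityCover d) x x′ → embed x ≈ embed x′
      preserves x _ (i , refl) = subst (embed x ≈_) (embed-step i x) (lift-adjacent i (embed x))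
      reflects : ∀ x x′ → embed x ≈ embed x′ → _~_ (ParityCover d) x x′
      reflects (u , s) (v , t) adjacent
        with differ≡1⇒flip u v (subst₂ (λ p q → differ p q ≡ 1) (γ-embed u s) (γ-embed v t) (homomorphism _ _ adjacent))
      ... | i , refl = i , embed-injective (begin
        embed (flip i u , t)     ≡⟨ lift-unique i _ _ adjacent (trans (γ-embed _ t) (cong (flip i) (sym (γ-embed u s)))) ⟩
        lift i (embed (u , s))   ≡⟨ embed-step i (u , s) ⟩
        embed (step i (u , s))   ∎)

isCohenTits⇒≅parityCover : {d : ℕ} (Y : Graph) → IsCohenTitsCover d Y → Isomorphic (ParityCover d) Y
isCohenTits⇒≅parityCover Y ((~-sym , _) , (γ , covering) , no-square) =
  CoverOfCube.parityCover≅ Y γ covering ~-sym no-square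

-- Invariance under isomorphism

Isomorphic-trans : {X₁ X₂ X₃ : Graph} → Isomorphic X₁ X₂ → Isomorphic X₂ X₃ → Isomorphic X₁ X₃
Isomorphic-trans (f , g , gf , fg , f~) (f′ , g′ , gf′ , fg′ , f~′) =
  f′ ∘ f , g ∘ g′ ,
  (λ x → trans (cong g (gf′ (f x))) (gf x)) ,
  (λ z → trans (cong f′ (fg (g′ z))) (fg′ z)) ,
  λ x x′ → proj₁ (f~′ (f x) (f x′)) ∘ proj₁ (f~ x x′) , proj₂ (f~ x x′) ∘ proj₂ (f~′ (f x) (f x′))

module _ {f : S → T} {g : T → S} (gf : ∀ x → g (f x) ≡ x) (fg : ∀ y → f (g y) ≡ y) where

  ExactlyTwo-preimage : {P : T → Set} → ExactlyTwo P → ExactlyTwo (λ x → P (f x))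
  ExactlyTwo-preimage {P} (a , b , a≢b , Pa , Pb , only) =
    g a , g b , (λ e → a≢b (trans (sym (fg a)) (trans (cong f e) (fg b)))) ,
    subst P (sym (fg a)) Pa , subst P (sym (fg b)) Pb ,
    λ x Pfx → Sum.map (pull x) (pull x) (only (f x) Pfx)
    where
    pull : ∀ x {y} → f x ≡ y → x ≡ g y
    pull x e = trans (sym (gf x)) (cong g e)

  ∃!-preimage : {P : T → Set} {R : S → Set} → (∀ x → R x → P (f x)) → (∀ x → P (f x) → R x) →
    ∃! P → ∃! R
  ∃!-preimage {P} to from (b , Pb , only) =
    g b , from (g b) (subst P (sym (fg b)) Pb) ,
    λ x Rx → trans (sym (gf x)) (cong g (only (f x) (to x Rx)))

isTwoFoldCovering-transport : {Z W Y : Graph} (iso : Isomorphic Z W) {γ : V W → V Y} →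
  IsTwoFoldCovering W Y γ → IsTwoFoldCovering Z Y (γ ∘ proj₁ iso)
isTwoFoldCovering-transport (f , g , gf , fg , f~) (homomorphism , independent , fibres , matching) =
  (λ x y → homomorphism (f x) (f y) ∘ proj₁ (f~ x y)) ,
  (λ x y over → independent (f x) (f y) over ∘ proj₁ (f~ x y)) ,
  (λ u → ExactlyTwo-preimage gf fg (fibres u)) ,
  λ u v uv x x-over → ∃!-preimage gf fg
    (λ y → Product.map₂ (proj₁ (f~ x y))) (λ y → Product.map₂ (proj₂ (f~ x y)))
    (matching u v uv (f x) x-over)

isSimple-transport : {Z W : Graph} → Isomorphic Z W → IsSimple W → IsSimple Z
isSimple-transport (f , g , gf , fg , f~) (~-sym , irreflexive) =
  (λ x y → proj₂ (f~ y x) ∘ ~-sym (f x) (f y) ∘ proj₁ (f~ x y)) ,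
  (λ x → irreflexive (f x) ∘ proj₁ (f~ x x))

hasFourCycle-transport : {Z W : Graph} → Isomorphic Z W → HasFourCycle Z → HasFourCycle W
hasFourCycle-transport (f , g , gf , fg , f~)
  (a , b , c , e , a≢b , a≢c , a≢e , b≢c , b≢e , c≢e , ab , bc , ce , ea) =
  f a , f b , f c , f e ,
  a≢b ∘ injective , a≢c ∘ injective , a≢e ∘ injective , b≢c ∘ injective , b≢e ∘ injective , c≢e ∘ injective ,
  proj₁ (f~ a b) ab , proj₁ (f~ b c) bc , proj₁ (f~ c e) ce , proj₁ (f~ e a) ea
  where
  injective : ∀ {x y} → f x ≡ f y → x ≡ y
  injective {x} {y} e = trans (sym (gf x)) (trans (cong g e) (gf y))

isCohenTitsCover-transport : {d : ℕ} {Z W : Graph} → Isomorphic Z W → IsCohenTitsCover d W → IsCohenTitsCover d Z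
isCohenTitsCover-transport iso (simple , (γ , covering) , no-square) =
  isSimple-transport iso simple ,
  (γ ∘ proj₁ iso , isTwoFoldCovering-transport iso covering) ,
  no-square ∘ hasFourCycle-transport iso

-- The matrices A_d in binary coordinates

unhalf : (k : ℕ) → Fin (2 ^ k) ⊎ Fin (2 ^ k) → Fin (2 ^ suc k)
unhalf k (inj₁ a) = a ↑ˡ (2 ^ k + 0)
unhalf k (inj₂ b) = (2 ^ k) ↑ʳ cast (sym (+-identityʳ (2 ^ k))) b

half-unhalf : ∀ k x → half k (unhalf k x) ≡ x
half-unhalf k (inj₁ a) rewrite splitAt-↑ˡ (2 ^ k) a (2 ^ k + 0) = refl
half-unhalf k (inj₂ b) rewrite splitAt-↑ʳ (2 ^ k) (2 ^ k + 0) (cast (sym (+-identityʳ (2 ^ k))) b) =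
  cong inj₂ (cast-involutive (+-identityʳ (2 ^ k)) (sym (+-identityʳ (2 ^ k))) b)

unhalf-half : ∀ k i → unhalf k (half k i) ≡ i
unhalf-half k i with splitAt (2 ^ k) {2 ^ k + 0} i in eq
... | inj₁ a = splitAt⁻¹-↑ˡ eq
... | inj₂ b = trans (cong ((2 ^ k) ↑ʳ_) (cast-involutive (sym (+-identityʳ (2 ^ k))) (+-identityʳ (2 ^ k)) b))
                     (splitAt⁻¹-↑ʳ eq)

-- The first bit says in which half (block row) of A_d an index lies.
toBits : (d : ℕ) → Fin (2 ^ d) → Vec Bool d
toBits zero _ = []
toBits (suc k) i with half k i
... | inj₁ a = false ∷ toBits k a
... | inj₂ b = true ∷ toBits k b

fromBits : (d : ℕ) → Vec Bool d → Fin (2 ^ d)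
fromBits zero [] = zero
fromBits (suc k) (false ∷ v) = unhalf k (inj₁ (fromBits k v))
fromBits (suc k) (true ∷ v) = unhalf k (inj₂ (fromBits k v))

toBits-fromBits : ∀ d v → toBits d (fromBits d v) ≡ v
toBits-fromBits zero [] = refl
toBits-fromBits (suc k) (false ∷ v) rewrite half-unhalf k (inj₁ (fromBits k v)) = cong (false ∷_) (toBits-fromBits k v)
toBits-fromBits (suc k) (true ∷ v) rewrite half-unhalf k (inj₂ (fromBits k v)) = cong (true ∷_) (toBits-fromBits k v)

fromBits-toBits : ∀ d i → fromBits d (toBits d i) ≡ i
fromBits-toBits zero zero = refl
fromBits-toBits (suc k) i with half k i in eq
... | inj₁ a = trans (cong (unhalf k ∘ inj₁) (fromBits-toBits k a)) (trans (cong (unhalf k) (sym eq)) (unhalf-half k i))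
... | inj₂ b = trans (cong (unhalf k ∘ inj₂) (fromBits-toBits k b)) (trans (cong (unhalf k) (sym eq)) (unhalf-half k i))

toBits-injective : ∀ d {i j} → toBits d i ≡ toBits d j → i ≡ j
toBits-injective d {i} {j} e = trans (sym (fromBits-toBits d i)) (trans (cong (fromBits d) e) (fromBits-toBits d j))

δᵇ : Vec Bool n → Vec Bool n → ℤ
δᵇ u v = if does (Vec.≡-dec _≟ᵇ_ u v) then 1ℤ else 0ℤ

Aᵇ : Vec Bool n → Vec Bool n → ℤ
Aᵇ [] [] = 0ℤ
Aᵇ (false ∷ u) (false ∷ v) = Aᵇ u v
Aᵇ (false ∷ u) (true ∷ v) = δᵇ u v
Aᵇ (true ∷ u) (false ∷ v) = δᵇ u v
Aᵇ (true ∷ u) (true ∷ v) = - Aᵇ u v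

δ≡δᵇ : ∀ d (a b : Fin (2 ^ d)) → δ a b ≡ δᵇ (toBits d a) (toBits d b)
δ≡δᵇ d a b with a ≟ b | Vec.≡-dec _≟ᵇ_ (toBits d a) (toBits d b)
... | yes _ | yes _ = refl
... | no _ | no _ = refl
... | yes a≡b | no ≢ = contradiction (cong (toBits d) a≡b) ≢
... | no a≢b | yes ≡ = contradiction (toBits-injective d ≡) a≢b

A′≡Aᵇ : ∀ k i j → A′ k i j ≡ Aᵇ (toBits (suc k) i) (toBits (suc k) j)
A′≡Aᵇ zero zero zero = refl
A′≡Aᵇ zero zero (suc zero) = refl
A′≡Aᵇ zero (suc zero) zero = refl
A′≡Aᵇ zero (suc zero) (suc zero) = refl
A′≡Aᵇ (suc k) i j with half (suc k) i | half (suc k) j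
... | inj₁ a | inj₁ b = A′≡Aᵇ k a b
... | inj₁ a | inj₂ b = δ≡δᵇ (suc k) a b
... | inj₂ a | inj₁ b = δ≡δᵇ (suc k) a b
... | inj₂ a | inj₂ b = cong -_ (A′≡Aᵇ k a b)

sign : Bool → ℤ
sign false = 1ℤ
sign true = -1ℤ

δᵇ-refl : (u : Vec Bool n) → δᵇ u u ≡ 1ℤ
δᵇ-refl u with Vec.≡-dec _≟ᵇ_ u u
... | yes _ = refl
... | no u≢u = contradiction refl u≢u

δᵇ≢0⇒≡ : {u v : Vec Bool n} → δᵇ u v ≢ 0ℤ → u ≡ v
δᵇ≢0⇒≡ {u = u} {v} nonzero with Vec.≡-dec _≟ᵇ_ u v
... | yes u≡v = u≡v
... | no _ = contradiction refl nonzero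

Aᵇ-flip : (i : Fin n) (u : Vec Bool n) → Aᵇ u (flip i u) ≡ sign (prefixParity u i)
Aᵇ-flip zero (false ∷ u) = δᵇ-refl u
Aᵇ-flip zero (true ∷ u) = δᵇ-refl u
Aᵇ-flip (suc i) (false ∷ u) = Aᵇ-flip i u
Aᵇ-flip (suc i) (true ∷ u) = trans (cong -_ (Aᵇ-flip i u)) (-sign (prefixParity u i))
  where
  -sign : ∀ c → - sign c ≡ sign (not c)
  -sign false = refl
  -sign true = refl

Aᵇ≢0⇒flip : (u v : Vec Bool n) → Aᵇ u v ≢ 0ℤ → Σ (Fin n) λ i → v ≡ flip i u
Aᵇ≢0⇒flip [] [] nonzero = contradiction refl nonzero
Aᵇ≢0⇒flip (false ∷ u) (false ∷ v) nonzero = Product.map suc (cong (false ∷_)) (Aᵇ≢0⇒flip u v nonzero)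
Aᵇ≢0⇒flip (true ∷ u) (true ∷ v) nonzero = Product.map suc (cong (true ∷_)) (Aᵇ≢0⇒flip u v (nonzero ∘ cong -_))
Aᵇ≢0⇒flip (false ∷ u) (true ∷ v) nonzero = zero , cong (true ∷_) (sym (δᵇ≢0⇒≡ nonzero))
Aᵇ≢0⇒flip (true ∷ u) (false ∷ v) nonzero = zero , cong (false ∷_) (sym (δᵇ≢0⇒≡ nonzero))

SignedEdge : ℤ → Bool → Bool → Set
SignedEdge a s t = (a ≡ 1ℤ × s ≡ t) ⊎ (a ≡ -1ℤ × s ≢ t)

signedEdge-nonzero : ∀ {a s t} → SignedEdge a s t → a ≢ 0ℤ
signedEdge-nonzero (inj₁ (refl , _)) ()
signedEdge-nonzero (inj₂ (refl , _)) ()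

signedEdge-sign⇒ : ∀ c {s t} → SignedEdge (sign c) s t → t ≡ s xor c
signedEdge-sign⇒ false {s} (inj₁ (_ , s≡t)) = trans (sym s≡t) (sym (xor-identityʳ s))
signedEdge-sign⇒ true {s} (inj₂ (_ , s≢t)) = trans (¬-not (s≢t ∘ sym)) (sym (xor-comm s true))

signedEdge-sign⇐ : ∀ c s → SignedEdge (sign c) s (s xor c)
signedEdge-sign⇐ false s = inj₁ (refl , sym (xor-identityʳ s))
signedEdge-sign⇐ true false = inj₂ (refl , λ ())
signedEdge-sign⇐ true true = inj₂ (refl , λ ())

signedEdge⇔step : (u v : Vec Bool n) (s t : Bool) →
  (SignedEdge (Aᵇ u v) s t → Σ (Fin n) λ i → (v , t) ≡ step i (u , s)) ×
  ((Σ (Fin n) λ i → (v , t) ≡ step i (u , s)) → SignedEdge (Aᵇ u v) s t)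
signedEdge⇔step u v s t = to , from
  where
  to : SignedEdge (Aᵇ u v) s t → Σ _ λ i → (v , t) ≡ step i (u , s)
  to edge with Aᵇ≢0⇒flip u v (signedEdge-nonzero edge)
  ... | i , refl = i , cong (flip i u ,_)
    (signedEdge-sign⇒ (prefixParity u i) (subst (λ a → SignedEdge a s t) (Aᵇ-flip i u) edge))
  from : (Σ _ λ i → (v , t) ≡ step i (u , s)) → SignedEdge (Aᵇ u v) s t
  from (i , refl) = subst (λ a → SignedEdge a s (s xor prefixParity u i)) (sym (Aᵇ-flip i u))
    (signedEdge-sign⇐ (prefixParity u i) s)

signedCover≅parityCover : (k : ℕ) → Isomorphic (SignedCover (suc k)) (ParityCover (suc k))
signedCover≅parityCover k =
  Product.map₁ (toBits (suc k)) , Product.map₁ (fromBits (suc k)) ,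
  (λ (i , s) → cong (_, s) (fromBits-toBits (suc k) i)) ,
  (λ (u , s) → cong (_, s) (toBits-fromBits (suc k) u)) ,
  λ (i , s) (j , t) →
    let (to , from) = signedEdge⇔step (toBits (suc k) i) (toBits (suc k) j) s t
        A≡ = A′≡Aᵇ k i j
    in to ∘ subst (λ a → SignedEdge a s t) A≡ , subst (λ a → SignedEdge a s t) (sym A≡) ∘ from

corollary2p2 : (d : ℕ) → {{_ : NonZero d}} →
    IsCohenTitsCover d (SignedCover d)
    × ((Y : Graph) → IsCohenTitsCover d Y → Isomorphic (SignedCover d) Y)
corollary2p2 (suc k) =
  isCohenTitsCover-transport (signedCover≅parityCover k) (parityCover-isCohenTits (suc k)) ,
  λ Y cohenTits → Isomorphic-trans {X₃ = Y} (signedCover≅parityCover k) (isCohenTits⇒≅parityCover Y cohenTits)
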